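{- Let $n,r$ be positive integers. Given an $r$-colored partition $\Lambda=(P,\varphi)$ of $[n]$, for each $t\in[r]$ let $\Lambda_t$ be the (uncolored) partition of $[n]$ whose set of arcs $\mathrm{Arc}(\Lambda_t)$ is the set of arcs of $P$ of color $t$. Then the map $\Lambda\mapsto(\Lambda_1,\dots,\Lambda_r)$ is a bijection from the set of $r$-colored partitions of $[n]$ to the set of $r$-tuples $(P_1,\dots,P_r)$ of partitions of $[n]$ such that $\min(P_i)\cup\min(P_j)=\max(P_i)\cup\max(P_j)=[n]$ for all distinct $i,j\in[r]$.
   Context: $[n]=\{1,\dots,n\}$. A partition $P$ of $[n]$ is a set of disjoint nonempty blocks with union $[n]$; $\mathrm{Arc}(P)$ is the set of pairs $(i,j)$ with $i,j$ in the same block and $j$ the least element of that block greater than $i$ (a partition is determined by its arc set). $\min(P)$, $\max(P)$ are the sets of minimal and maximal elements of blocks. An $r$-colored partition is $\Lambda=(P,\varphi)$ with $\varphi:\mathrm{Arc}(P)\to[r]$. -}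

module Defs where

open import Data.Nat using (ℕ)
open import Data.Fin using (Fin; _<_)
open import Data.Bool using (Bool; T)
open import Data.Product using (_×_; Σ)
open import Data.Sum using (_⊎_)
open import Relation.Nullary using (¬_)
open import Relation.Binary.PropositionalEquality using (_≡_; _≢_)

_⟺_ : Set → Set → Set
A ⟺ B = (A → B) × (B → A)

-- A partition of [n] (elements Fin n), given by the (decidable) equivalence
-- relation "in the same block"; blocks are its equivalence classes.
record Partition (n : ℕ) : Set where
  field
    rel     : Fin n → Fin n → Bool
    reflexive  : ∀ i → T (rel i i)
    symmetric  : ∀ i j → T (rel i j) → T (rel j i)
    transitive : ∀ i j k → T (rel i j) → T (rel j k) → T (rel i k)
open Partition public

Same : ∀ {n} → Partition n → Fin n → Fin n → Set
Same P i j = T (rel P i j)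

_≋_ : ∀ {n} → Partition n → Partition n → Set
P ≋ Q = ∀ i j → Same P i j ⟺ Same Q i j

IsArc : ∀ {n} → Partition n → Fin n → Fin n → Set
IsArc P i j = (i < j) × Same P i j × (∀ k → i < k → k < j → ¬ Same P i k)

IsMin : ∀ {n} → Partition n → Fin n → Set
IsMin P i = ∀ k → k < i → ¬ Same P k i

IsMax : ∀ {n} → Partition n → Fin n → Set
IsMax P i = ∀ k → i < k → ¬ Same P i k

-- An r-colored partition (P , φ).  The coloring φ : Arc(P) → [r] is encoded as
-- a function on all pairs of which only the values on Arc(P) are relevant
-- (see _≋c_).
record Colored (n r : ℕ) : Set where
  constructor _,c_
  field
    part  : Partition n
    color : Fin n → Fin n → Fin r
open Colored public

_≋c_ : ∀ {n r} → Colored n r → Colored n r → Set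
Λ ≋c Λ' = (part Λ ≋ part Λ') × (∀ i j → IsArc (part Λ) i j → color Λ i j ≡ color Λ' i j)

Tuple : ℕ → ℕ → Set
Tuple n r = Fin r → Partition n

_≋t_ : ∀ {n r} → Tuple n r → Tuple n r → Set
Ps ≋t Qs = ∀ t → Ps t ≋ Qs t

Admissible : ∀ {n r} → Tuple n r → Set
Admissible Ps = ∀ i j → i ≢ j → ∀ k →
  (IsMin (Ps i) k ⊎ IsMin (Ps j) k) × (IsMax (Ps i) k ⊎ IsMax (Ps j) k)

Components : ∀ {n r} → Colored n r → Tuple n r → Set
Components Λ Ps = ∀ t i j →
  IsArc (Ps t) i j ⟺ (IsArc (part Λ) i j × color Λ i j ≡ t)

-- A partition is determined by its arc set, and the possible arc sets are
-- exactly the increasing partial injections of [n]: the block of j is recovered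
-- by following arcs back to the minimum of the block.  Colouring the arcs of P
-- thus amounts to splitting Arc(P) into r arc sets Arc(P_t).  Distinct arcs of
-- P have distinct sources and distinct targets; across the pieces this is
-- exactly the condition min(P_i) ∪ min(P_j) = max(P_i) ∪ max(P_j) = [n], under
-- which the union of the Arc(P_t) is again an arc set, each arc coloured by the
-- unique piece containing it.
module Submission where

open import Defs
open import Data.Nat using (ℕ; _<_; suc)
open import Data.Fin using (Fin; zero) renaming (_<_ to _<ᶠ_; _≤_ to _≤ᶠ_; _>_ to _>ᶠ_)

import Data.Nat.Properties as ℕ
open import Data.Fin.Properties using (_≟_; _<?_; any?; all?; ≤-refl; ≤-total; <-irrefl; <-cmp; ≤∧≢⇒<)
open import Data.Fin.Induction using (<-wellFounded; >-wellFounded)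
open import Data.Product using (_×_; Σ; _,_; proj₁; proj₂; ∃; map₁; map₂)
open import Data.Sum using (_⊎_; inj₁; inj₂)
open import Data.Empty using (⊥-elim)
open import Function using (_∘_; id; flip)
open import Induction.WellFounded using (Acc; acc)
open import Relation.Binary using (Rel; Decidable; _⇒_; tri<; tri≈; tri>)
open import Relation.Binary.Construct.Closure.ReflexiveTransitive using (Star; ε; _◅_; _◅◅_; fold; reverse)
import Relation.Binary.Construct.Closure.ReflexiveTransitive as Star
open import Relation.Nullary using (¬_; yes; no)
open import Relation.Nullary.Decidable using (⌊_⌋; toWitness; fromWitness; _×-dec_; _→-dec_; ¬?; T?)
open import Relation.Binary.PropositionalEquality using (_≡_; refl; sym; trans; subst)

⟺-sym : ∀ {A B} → A ⟺ B → B ⟺ A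
⟺-sym (f , g) = g , f

⟺-trans : ∀ {A B C} → A ⟺ B → B ⟺ C → A ⟺ C
⟺-trans (f , g) (f′ , g′) = f′ ∘ f , g ∘ g′

≋t-sym : ∀ {n r} {Ps Qs : Tuple n r} → Ps ≋t Qs → Qs ≋t Ps
≋t-sym e t i j = ⟺-sym (e t i j)

module _ {a ℓ} {A : Set a} {R : Rel A ℓ} where

  Star-comparable : (∀ {x y z} → R x y → R x z → y ≡ z) →
                    ∀ {x y z} → Star R x y → Star R x z → Star R y z ⊎ Star R z y
  Star-comparable functional ε       q       = inj₁ q
  Star-comparable functional (p ◅ ps) ε      = inj₂ (p ◅ ps)
  Star-comparable functional (p ◅ ps) (q ◅ qs) with functional p q
  ... | refl = Star-comparable functional ps qs

  Star-from-terminal : ∀ {x y} → (∀ {z} → ¬ R x z) → Star R x y → x ≡ y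
  Star-from-terminal terminal ε       = refl
  Star-from-terminal terminal (p ◅ _) = ⊥-elim (terminal p)

Star-increasing : ∀ {n ℓ} {R : Rel (Fin n) ℓ} → R ⇒ _<ᶠ_ → Star R ⇒ _≤ᶠ_
Star-increasing increasing = fold _≤ᶠ_ (λ r → ℕ.≤-trans (ℕ.<⇒≤ (increasing r))) ≤-refl

kernel : ∀ {n m} → (Fin n → Fin m) → Partition n
kernel f = record
  { rel        = λ i j → ⌊ f i ≟ f j ⌋
  ; reflexive  = λ i → fromWitness refl
  ; symmetric  = λ i j p → fromWitness (sym (toWitness p))
  ; transitive = λ i j k p q → fromWitness (trans (toWitness p) (toWitness q))
  }

Same-kernel⇒ : ∀ {n m} (f : Fin n → Fin m) {i j} → Same (kernel f) i j → f i ≡ f j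
Same-kernel⇒ f = toWitness

Same-kernel⇐ : ∀ {n m} (f : Fin n → Fin m) {i j} → f i ≡ f j → Same (kernel f) i j
Same-kernel⇐ f = fromWitness

module _ {n} (P : Partition n) where

  IsArc? : Decidable (IsArc P)
  IsArc? i j = (i <? j) ×-dec T? (rel P i j) ×-dec
    all? (λ k → (i <? k) →-dec ((k <? j) →-dec ¬? (T? (rel P i k))))

  IsArc-functional : ∀ {i j j′} → IsArc P i j → IsArc P i j′ → j ≡ j′
  IsArc-functional {j = j} {j′} (i<j , s , gap) (i<j′ , s′ , gap′) with <-cmp j j′
  ... | tri< j<j′ _ _ = ⊥-elim (gap′ j i<j j<j′ s)
  ... | tri≈ _ j≡j′ _ = j≡j′
  ... | tri> _ _ j′<j = ⊥-elim (gap j′ i<j′ j′<j s′)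

  IsArc-injective : ∀ {i i′ j} → IsArc P i j → IsArc P i′ j → i ≡ i′
  IsArc-injective {i} {i′} {j} (i<j , s , gap) (i′<j , s′ , gap′) with <-cmp i i′
  ... | tri< i<i′ _ _ = ⊥-elim (gap i′ i<i′ i′<j (transitive P i j i′ s (symmetric P i′ j s′)))
  ... | tri≈ _ i≡i′ _ = i≡i′
  ... | tri> _ _ i′<i = ⊥-elim (gap′ i i′<i i<j (transitive P i′ j i s′ (symmetric P i j s)))

  arc-path⇒Same : Star (IsArc P) ⇒ Same P
  arc-path⇒Same {i} ε                   = reflexive P i
  arc-path⇒Same {i} (_◅_ {j = m} a as) = transitive P i m _ (proj₁ (proj₂ a)) (arc-path⇒Same as)

  outgoing-arc : ∀ {i j} → Same P i j → i <ᶠ j → ∃ λ m → IsArc P i m × m ≤ᶠ j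
  outgoing-arc {i} {j} = go (<-wellFounded j)
    where
    go : ∀ {j} → Acc _<ᶠ_ j → Same P i j → i <ᶠ j → ∃ λ m → IsArc P i m × m ≤ᶠ j
    go {j} (acc rec) s i<j with any? (λ k → (i <? k) ×-dec (k <? j) ×-dec T? (rel P i k))
    ... | yes (k , i<k , k<j , sk) =
      map₂ (map₂ (λ m≤k → ℕ.≤-trans m≤k (ℕ.<⇒≤ k<j))) (go (rec k<j) sk i<k)
    ... | no ∄k = j , (i<j , s , λ k i<k k<j sk → ∄k (k , i<k , k<j , sk)) , ≤-refl

  Same⇒arc-path : ∀ {i j} → Same P i j → i ≤ᶠ j → Star (IsArc P) i j
  Same⇒arc-path {i} = go (>-wellFounded i)
    where
    go : ∀ {i j} → Acc _>ᶠ_ i → Same P i j → i ≤ᶠ j → Star (IsArc P) i j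
    go {i} {j} (acc rec) s i≤j with i ≟ j
    ... | yes refl = ε
    ... | no i≢j with outgoing-arc s (≤∧≢⇒< i≤j i≢j)
    ...   | m , arc@(i<m , sm , _) , m≤j =
      arc ◅ go (rec i<m) (transitive P m i j (symmetric P i m sm) s) m≤j

  IsMin⊎incoming-arc : ∀ k → IsMin P k ⊎ ∃ λ x → IsArc P x k
  IsMin⊎incoming-arc k with any? (λ x → (x <? k) ×-dec T? (rel P x k))
  ... | no ∄x = inj₁ (λ x x<k s → ∄x (x , x<k , s))
  ... | yes (x , x<k , s) with reverse id (Same⇒arc-path s (ℕ.<⇒≤ x<k))
  ...   | ε          = ⊥-elim (<-irrefl refl x<k)
  ...   | arc ◅ _    = inj₂ (_ , arc)

  IsMax⊎outgoing-arc : ∀ k → IsMax P k ⊎ ∃ λ y → IsArc P k y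
  IsMax⊎outgoing-arc k with any? (λ y → (k <? y) ×-dec T? (rel P k y))
  ... | no ∄y = inj₁ (λ y k<y s → ∄y (y , k<y , s))
  ... | yes (y , k<y , s) = inj₂ (map₂ proj₁ (outgoing-arc s k<y))

Same-mono : ∀ {n} (P Q : Partition n) → IsArc P ⇒ IsArc Q → Same P ⇒ Same Q
Same-mono P Q arcs {i} {j} s with ≤-total i j
... | inj₁ i≤j = arc-path⇒Same Q (Star.map arcs (Same⇒arc-path P s i≤j))
... | inj₂ j≤i =
  symmetric Q j i (arc-path⇒Same Q (Star.map arcs (Same⇒arc-path P (symmetric P i j s) j≤i)))

≋-fromIsArc : ∀ {n} (P Q : Partition n) → (∀ i j → IsArc P i j ⟺ IsArc Q i j) → P ≋ Q
≋-fromIsArc P Q arcs i j = Same-mono P Q (proj₁ (arcs _ _)) , Same-mono Q P (proj₂ (arcs _ _))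

IsArc-resp-≋ : ∀ {n} (P Q : Partition n) → P ≋ Q → IsArc P ⇒ IsArc Q
IsArc-resp-≋ P Q e {i} {j} (i<j , s , gap) =
  i<j , proj₁ (e i j) s , λ k i<k k<j sk → gap k i<k k<j (proj₂ (e i k) sk)

record ArcSet (n : ℕ) : Set₁ where
  field
    Arc            : Fin n → Fin n → Set
    arc?           : Decidable Arc
    arc-increasing : Arc ⇒ _<ᶠ_
    arc-functional : ∀ {i j j′} → Arc i j → Arc i j′ → j ≡ j′
    arc-injective  : ∀ {i i′ j} → Arc i j → Arc i′ j → i ≡ i′
open ArcSet

arcSet : ∀ {n} → Partition n → ArcSet n
arcSet P = record
  { Arc            = IsArc P
  ; arc?           = IsArc? P
  ; arc-increasing = proj₁
  ; arc-functional = IsArc-functional P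
  ; arc-injective  = IsArc-injective P
  }

restrict : ∀ {n} (S : ArcSet n) {Q : Fin n → Fin n → Set} → Decidable Q → ArcSet n
restrict S {Q} Q? = record
  { Arc            = λ i j → Arc S i j × Q i j
  ; arc?           = λ i j → arc? S i j ×-dec Q? i j
  ; arc-increasing = arc-increasing S ∘ proj₁
  ; arc-functional = λ a b → arc-functional S (proj₁ a) (proj₁ b)
  ; arc-injective  = λ a b → arc-injective S (proj₁ a) (proj₁ b)
  }

module _ {n} (S : ArcSet n) where

  Initial : Fin n → Set
  Initial r = ∀ {i} → ¬ Arc S i r

  backward-chain : ∀ j → Σ (Fin n) λ r → Star (flip (Arc S)) j r × Initial r
  backward-chain j = go (<-wellFounded j)
    where
    go : ∀ {j} → Acc _<ᶠ_ j → Σ (Fin n) λ r → Star (flip (Arc S)) j r × Initial r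
    go {j} (acc rec) with any? (λ i → arc? S i j)
    ... | yes (i , a) = map₂ (map₁ (a ◅_)) (go (rec (arc-increasing S a)))
    ... | no ∄i       = j , ε , λ a → ∄i (_ , a)

  start : Fin n → Fin n
  start j = proj₁ (backward-chain j)

  start-path : ∀ j → Star (flip (Arc S)) j (start j)
  start-path j = proj₁ (proj₂ (backward-chain j))

  start-initial : ∀ j → Initial (start j)
  start-initial j = proj₂ (proj₂ (backward-chain j))

  start-unique : ∀ {j r} → Star (flip (Arc S)) j r → Initial r → start j ≡ r
  start-unique {j} p r-initial with Star-comparable (arc-injective S) p (start-path j)
  ... | inj₁ q = sym (Star-from-terminal r-initial q)
  ... | inj₂ q = Star-from-terminal (start-initial j) q

  arc-path⇒same-start : ∀ {i j} → Star (Arc S) i j → start i ≡ start j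
  arc-path⇒same-start {i} p = sym (start-unique (reverse id p ◅◅ start-path i) (start-initial i))

  same-start⇒arc-path : ∀ {i j} → start i ≡ start j → Star (Arc S) i j ⊎ Star (Arc S) j i
  same-start⇒arc-path {i} {j} e = Star-comparable (arc-functional S) (path-from-start i)
                           (subst (λ r → Star (Arc S) r j) (sym e) (path-from-start j))
    where
    path-from-start : ∀ j → Star (Arc S) (start j) j
    path-from-start j = reverse id (start-path j)

  partitionOf : Partition n
  partitionOf = kernel start

  IsArc-partitionOf : ∀ i j → IsArc partitionOf i j ⟺ Arc S i j
  IsArc-partitionOf i j = arc , isArc
    where
    arc : IsArc partitionOf i j → Arc S i j
    arc (i<j , s , gap) with same-start⇒arc-path (Same-kernel⇒ start s)
    ... | inj₂ p           = ⊥-elim (ℕ.<⇒≱ i<j (Star-increasing (arc-increasing S) p))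
    ... | inj₁ ε           = ⊥-elim (<-irrefl refl i<j)
    ... | inj₁ (a ◅ ε)     = a
    ... | inj₁ (a ◅ b ◅ p) = ⊥-elim (gap _ (arc-increasing S a)
                               (ℕ.<-≤-trans (arc-increasing S b) (Star-increasing (arc-increasing S) p))
                               (Same-kernel⇐ start (arc-path⇒same-start (a ◅ ε))))

    isArc : Arc S i j → IsArc partitionOf i j
    isArc a = arc-increasing S a , Same-kernel⇐ start (arc-path⇒same-start (a ◅ ε)) , gap
      where
      gap : ∀ k → i <ᶠ k → k <ᶠ j → ¬ Same partitionOf i k
      gap k i<k k<j s with same-start⇒arc-path (Same-kernel⇒ start s)
      ... | inj₂ p       = ℕ.<⇒≱ i<k (Star-increasing (arc-increasing S) p)
      ... | inj₁ ε       = <-irrefl refl i<k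
      ... | inj₁ (b ◅ p) with arc-functional S a b
      ...   | refl = ℕ.<⇒≱ k<j (Star-increasing (arc-increasing S) p)

module _ {n r : ℕ} where

  colourClass : Colored n r → Fin r → ArcSet n
  colourClass Λ t = restrict (arcSet (part Λ)) (λ i j → color Λ i j ≟ t)

  split : Colored n r → Tuple n r
  split Λ t = partitionOf (colourClass Λ t)

  split-components : (Λ : Colored n r) → Components Λ (split Λ)
  split-components Λ t = IsArc-partitionOf (colourClass Λ t)

  Components-unique : (Λ : Colored n r) (Ps : Tuple n r) → Components Λ Ps → Ps ≋t split Λ
  Components-unique Λ Ps c t =
    ≋-fromIsArc (Ps t) (split Λ t) (λ i j → ⟺-trans (c t i j) (⟺-sym (split-components Λ t i j)))

  split-admissible : (Λ : Colored n r) → Admissible (split Λ)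
  split-admissible Λ t s t≢s k = mins , maxs
    where
    arc : ∀ {t i j} → IsArc (split Λ t) i j → IsArc (part Λ) i j × color Λ i j ≡ t
    arc {t} = proj₁ (split-components Λ t _ _)

    mins : IsMin (split Λ t) k ⊎ IsMin (split Λ s) k
    mins with IsMin⊎incoming-arc (split Λ t) k | IsMin⊎incoming-arc (split Λ s) k
    ... | inj₁ k-min | _          = inj₁ k-min
    ... | inj₂ _     | inj₁ k-min = inj₂ k-min
    ... | inj₂ (_ , a) | inj₂ (_ , b) with IsArc-injective (part Λ) (proj₁ (arc a)) (proj₁ (arc b))
    ...   | refl = ⊥-elim (t≢s (trans (sym (proj₂ (arc a))) (proj₂ (arc b))))

    maxs : IsMax (split Λ t) k ⊎ IsMax (split Λ s) k
    maxs with IsMax⊎outgoing-arc (split Λ t) k | IsMax⊎outgoing-arc (split Λ s) k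
    ... | inj₁ k-max | _          = inj₁ k-max
    ... | inj₂ _     | inj₁ k-max = inj₂ k-max
    ... | inj₂ (_ , a) | inj₂ (_ , b) with IsArc-functional (part Λ) (proj₁ (arc a)) (proj₁ (arc b))
    ...   | refl = ⊥-elim (t≢s (trans (sym (proj₂ (arc a))) (proj₂ (arc b))))

  split-injective : (Λ Λ′ : Colored n r) → split Λ ≋t split Λ′ → Λ ≋c Λ′
  split-injective Λ Λ′ e =
    ≋-fromIsArc (part Λ) (part Λ′)
      (λ i j → proj₁ ∘ transport Λ Λ′ e , proj₁ ∘ transport Λ′ Λ (≋t-sym {Ps = split Λ} {split Λ′} e)) ,
    λ i j a → sym (proj₂ (transport Λ Λ′ e a))
    where
    transport : ∀ Λ Λ′ → split Λ ≋t split Λ′ → ∀ {i j} → IsArc (part Λ) i j →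
                IsArc (part Λ′) i j × color Λ′ i j ≡ color Λ i j
    transport Λ Λ′ e {i} {j} a = proj₁ (split-components Λ′ t i j)
      (IsArc-resp-≋ (split Λ t) (split Λ′ t) (e t) (proj₂ (split-components Λ t i j) (a , refl)))
      where t = color Λ i j

module _ {n r : ℕ} (Ps : Tuple n r) (adm : Admissible Ps) where

  outgoing-colour-unique : ∀ {t s i j j′} → IsArc (Ps t) i j → IsArc (Ps s) i j′ → t ≡ s
  outgoing-colour-unique {t} {s} {i} a b with t ≟ s
  ... | yes t≡s = t≡s
  ... | no t≢s with proj₂ (adm t s t≢s i)
  ...   | inj₁ i-max = ⊥-elim (i-max _ (proj₁ a) (proj₁ (proj₂ a)))
  ...   | inj₂ i-max = ⊥-elim (i-max _ (proj₁ b) (proj₁ (proj₂ b)))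

  incoming-colour-unique : ∀ {t s i i′ j} → IsArc (Ps t) i j → IsArc (Ps s) i′ j → t ≡ s
  incoming-colour-unique {t} {s} {j = j} a b with t ≟ s
  ... | yes t≡s = t≡s
  ... | no t≢s with proj₁ (adm t s t≢s j)
  ...   | inj₁ j-min = ⊥-elim (j-min _ (proj₁ a) (proj₁ (proj₂ a)))
  ...   | inj₂ j-min = ⊥-elim (j-min _ (proj₁ b) (proj₁ (proj₂ b)))

  union : ArcSet n
  union = record
    { Arc            = λ i j → ∃ λ t → IsArc (Ps t) i j
    ; arc?           = λ i j → any? (λ t → IsArc? (Ps t) i j)
    ; arc-increasing = proj₁ ∘ proj₂
    ; arc-functional = λ { (t , a) (s , b) → functional (outgoing-colour-unique a b) a b }
    ; arc-injective  = λ { (t , a) (s , b) → injective (incoming-colour-unique a b) a b }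
    }
    where
    functional : ∀ {t s i j j′} → t ≡ s → IsArc (Ps t) i j → IsArc (Ps s) i j′ → j ≡ j′
    functional {t} refl = IsArc-functional (Ps t)
    injective : ∀ {t s i i′ j} → t ≡ s → IsArc (Ps t) i j → IsArc (Ps s) i′ j → i ≡ i′
    injective {t} refl = IsArc-injective (Ps t)

  mergeColour : Fin r → Fin n → Fin n → Fin r
  mergeColour t₀ i j with any? (λ t → IsArc? (Ps t) i j)
  ... | yes (t , _) = t
  ... | no _        = t₀

  mergeColour-arc : ∀ {t₀ t i j} → IsArc (Ps t) i j → mergeColour t₀ i j ≡ t
  mergeColour-arc {t = t} {i} {j} a with any? (λ t → IsArc? (Ps t) i j)
  ... | yes (s , b) = outgoing-colour-unique b a
  ... | no ∄t       = ⊥-elim (∄t (t , a))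

  merge : Fin r → Colored n r
  merge t₀ = partitionOf union ,c mergeColour t₀

  split-merge : ∀ t₀ → split (merge t₀) ≋t Ps
  split-merge t₀ t = ≋-fromIsArc (split (merge t₀) t) (Ps t)
    (λ i j → ⟺-trans (split-components (merge t₀) t i j) (fromArc , toArc))
    where
    fromArc : ∀ {i j} → IsArc (partitionOf union) i j × mergeColour t₀ i j ≡ t → IsArc (Ps t) i j
    fromArc {i} {j} (a , c) with proj₁ (IsArc-partitionOf union i j) a
    ... | s , b with trans (sym (mergeColour-arc b)) c
    ...   | refl = b

    toArc : ∀ {i j} → IsArc (Ps t) i j → IsArc (partitionOf union) i j × mergeColour t₀ i j ≡ t
    toArc {i} {j} a = proj₂ (IsArc-partitionOf union i j) (t , a) , mergeColour-arc a

lemma1p2 : (n r : ℕ) → 0 < n → 0 < r →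
    Σ (Colored n r → Tuple n r) λ F →
      ((Λ : Colored n r) → Components Λ (F Λ))
      × ((Λ : Colored n r) (Ps : Tuple n r) → Components Λ Ps → Ps ≋t F Λ)
      × ((Λ : Colored n r) → Admissible (F Λ))
      × ((Λ Λ' : Colored n r) → F Λ ≋t F Λ' → Λ ≋c Λ')
      × ((Ps : Tuple n r) → Admissible Ps → Σ (Colored n r) λ Λ → F Λ ≋t Ps)
lemma1p2 n (suc r) _ _ =
  split , split-components , Components-unique , split-admissible , split-injective ,
  λ Ps adm → merge Ps adm zero , split-merge Ps adm zero
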